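{- Let $n\ge k\ge 1$ be integers, let $\eta$ be a $k$-partition of $n$, and let $G_\eta$ be the underlying multigraph of $D_\eta$. For any $X$ with $\emptyset\ne X\subsetneq V(D_\eta)$, the number of edges of $G_\eta$ joining $X$ and $V(D_\eta)\setminus X$ is at least $4$.
   Context: A $k$-partition of $n$ is a $k$-tuple $(p_1,\dots,p_k)$ of integers with $p_i\ge 1$ and $\sum p_i=n$. The multidigraph $D_\eta$ has vertex set $\bigcup_{i=1}^k\{v^i_1,\dots,v^i_{p_i}\}$ and arcs as follows. If $k=1$: arcs $(v^1_i,v^1_{i+1})$ and $(v^1_{i+1},v^1_i)$ for each $i=1,\dots,n$, with $v^1_{n+1}=v^1_1$. If $k\ge 2$: (1) arcs $(v^i_j,v^i_{j+1})$ and $(v^i_{j+1},v^i_j)$ for all $1\le i\le k$, $1\le j\le p_i-1$; (2) arcs $(v^i_1,v^{i+1}_1)$ and $(v^i_{p_i},v^{i+1}_{p_{i+1}})$ for all $1\le i\le k$, where $v^{k+1}_1=v^1_1$ and $v^{k+1}_{p_{k+1}}=v^1_{p_1}$. Arcs added in different steps are distinct even if they have the same tail and head. $G_\eta$ is the multigraph obtained by forgetting orientations (keeping parallel edges). -}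

module Defs where

open import Data.Nat using (ℕ; zero; suc; _+_; _≤_)
open import Data.Nat.DivMod using (_%_; m%n<n)
open import Data.Fin using (Fin; zero; suc; toℕ; fromℕ; fromℕ<)
open import Data.Bool using (Bool; true; false; if_then_else_; _xor_)
open import Data.Product using (Σ; _×_; _,_)
open import Data.List using (List; []; _∷_; _++_; map; concatMap; allFin)
open import Data.Vec using (Vec; []; _∷_; lookup; sum)
open import Data.Vec.Relation.Unary.All using (All)
open import Relation.Binary.PropositionalEquality using (_≡_)

IsPartition : (n k : ℕ) → Vec ℕ k → Set
IsPartition n k η = All (1 ≤_) η × (sum η ≡ n)

-- Vertex v^i_j (0-indexed: i : Fin k, j : Fin p_i).
Vertex : ∀ {k} → Vec ℕ k → Set
Vertex {k} η = Σ (Fin k) (λ i → Fin (lookup η i))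

next : ∀ {k} → Fin k → Fin k
next {suc m} i = fromℕ< (m%n<n (suc (toℕ i)) (suc m))

pathArcs : (m : ℕ) → List (Fin m × Fin m)
pathArcs zero = []
pathArcs (suc zero) = []
pathArcs (suc (suc m)) =
  (zero , suc zero) ∷ (suc zero , zero) ∷
  map (λ { (a , b) → (suc a , suc b) }) (pathArcs (suc m))

cycleArcs : (m : ℕ) → List (Fin m × Fin m)
cycleArcs zero = []
cycleArcs (suc a) = pathArcs (suc a) ++ ((fromℕ a , zero) ∷ (zero , fromℕ a) ∷ [])

-- arcs (v^i_1, v^{i+1}_1) and (v^i_{p_i}, v^{i+1}_{p_{i+1}})
-- (empty if a part is empty, which never happens for a partition)
endArcs : (a b : ℕ) → List (Fin a × Fin b)
endArcs (suc a) (suc b) = (zero , zero) ∷ (fromℕ a , fromℕ b) ∷ []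
endArcs _ _ = []

-- The arc multiset of D_η, as a list (each list entry is a distinct arc).
arcs : ∀ {k} → (η : Vec ℕ k) → List (Vertex η × Vertex η)
arcs [] = []
arcs (p ∷ []) = map (λ { (a , b) → ((zero , a) , (zero , b)) }) (cycleArcs p)
arcs {k} η@(_ ∷ _ ∷ _) = concatMap arcsOf (allFin k)
  where
  arcsOf : Fin k → List (Vertex η × Vertex η)
  arcsOf i =
    map (λ { (a , b) → ((i , a) , (i , b)) }) (pathArcs (lookup η i)) ++
    map (λ { (a , b) → ((i , a) , (next i , b)) })
        (endArcs (lookup η i) (lookup η (next i)))

-- Number of edges of G_η (arcs with orientation forgotten, parallel edges kept)
-- joining X and V \ X.
cutSize : ∀ {k} → (η : Vec ℕ k) → (Vertex η → Bool) → ℕ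
cutSize η X = go (arcs η)
  where
  go : List (Vertex η × Vertex η) → ℕ
  go [] = 0
  go ((u , v) ∷ es) = (if X u xor X v then 1 else 0) + go es

{-# OPTIONS --safe #-}
-- Both orientations of every path edge are arcs, so the cut is twice
-- the cut of the paths of the parts plus the cuts of two cycles, through the first and through
-- the last vertices of the parts. A cycle whose vertices in parts i and j differ in colour
-- crosses twice, so for i ≠ j the cut is at least twice the cut of the closed walk formed by the
-- paths of parts i and j and the edges joining their ends; that walk crosses twice as soon as it
-- meets both colours. Take i and j to be the parts of a true and of a false vertex; if these
-- coincide, take any other j, whose first vertex has a colour y while part i meets not y.
-- For k = 1 the graph is a cycle with doubled edges.
module Submission where

open import Defs
open import Data.Nat using (ℕ; zero; suc; _+_; _*_; _%_; _≤_; z≤n; s≤s)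
open import Data.Nat.Properties
  using ( +-identityʳ; +-assoc; m≤m+n; ≤-trans; ≤-reflexive; +-mono-≤; +-monoˡ-≤; +-monoʳ-≤; *-monoʳ-≤
        ; +-0-commutativeMonoid; +-*-semiring; module ≤-Reasoning)
open import Data.Nat.DivMod using (m<n⇒m%n≡m; n%n≡0)
open import Data.Nat.ListAction using (sum)
open import Data.Nat.ListAction.Properties using (sum-++)
open import Data.Nat.Tactic.RingSolver using (solve-∀)
open import Data.Bool using (Bool; true; false; not; if_then_else_; _xor_)
open import Data.Bool.Properties using (not-¬)
open import Data.Fin using (Fin; zero; suc; toℕ; fromℕ; inject₁; punchIn; punchOut)
open import Data.Fin.Properties
  using (_≟_; toℕ-injective; toℕ-fromℕ<; toℕ-fromℕ; toℕ-inject₁; toℕ<n; punchInᵢ≢i; punchIn-punchOut)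
open import Data.Product using (∃; _×_; _,_)
open import Data.List using (List; []; _∷_; _++_; map; concatMap; tabulate)
open import Data.List.Properties using (map-++; map-∘)
open import Data.Vec using (Vec; []; _∷_; lookup)
open import Data.Vec.Functional using (removeAt)
open import Data.Vec.Relation.Unary.All using (All)
open import Data.Vec.Relation.Unary.All.Properties using (lookup⁺)
open import Algebra.Properties.CommutativeMonoid.Sum +-0-commutativeMonoid
  using (sum-syntax; sum-cong-≗; sum-init-last; sum-remove; ∑-distrib-+)
open import Algebra.Properties.Semiring.Sum +-*-semiring using (*-distribˡ-sum)
open import Function using (_∘_; id)
open import Relation.Binary.PropositionalEquality
open import Relation.Nullary using (yes; no; contradiction)

open ≤-Reasoning

dist : Bool → Bool → ℕ
dist x y = if x xor y then 1 else 0

dist-refl : ∀ x → dist x x ≡ 0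
dist-refl true  = refl
dist-refl false = refl

dist-sym : ∀ x y → dist x y ≡ dist y x
dist-sym true  true  = refl
dist-sym true  false = refl
dist-sym false true  = refl
dist-sym false false = refl

dist-≢ : ∀ {x y} → x ≢ y → dist x y ≡ 1
dist-≢ {true}  {true}  x≢y = contradiction refl x≢y
dist-≢ {true}  {false} _   = refl
dist-≢ {false} {true}  _   = refl
dist-≢ {false} {false} x≢y = contradiction refl x≢y

dist-triangle : ∀ x y z → dist x z ≤ dist x y + dist y z
dist-triangle true  _     true  = z≤n
dist-triangle false _     false = z≤n
dist-triangle true  true  false = s≤s z≤n
dist-triangle true  false false = s≤s z≤n
dist-triangle false true  true  = s≤s z≤n
dist-triangle false false true  = s≤s z≤n

-- m bounds a walk f → l passing through x and through y, in either order; closed by the edge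
-- l f it crosses between x and y twice.
cycle-bound : ∀ f l x y {m} → dist f x + dist x l ≤ m → dist f y + dist y l ≤ m →
              2 * dist x y ≤ m + dist l f
cycle-bound _     _     true  true  _  _  = z≤n
cycle-bound _     _     false false _  _  = z≤n
cycle-bound true  true  true  false _  hy = ≤-trans hy (m≤m+n _ _)
cycle-bound false false true  false hx _  = ≤-trans hx (m≤m+n _ _)
cycle-bound true  false true  false hx _  = +-monoˡ-≤ 1 hx
cycle-bound false true  true  false hx _  = +-monoˡ-≤ 1 hx
cycle-bound true  true  false true  hx _  = ≤-trans hx (m≤m+n _ _)
cycle-bound false false false true  _  hy = ≤-trans hy (m≤m+n _ _)
cycle-bound true  false false true  _  hy = +-monoˡ-≤ 1 hy
cycle-bound false true  false true  _  hy = +-monoˡ-≤ 1 hy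

-- The walks fi → x → li and fj → y → lj close up, through the edges li lj and fj fi, into a
-- closed walk through x and y, which crosses between them twice.
closedWalk-bound : ∀ fi x li fj y lj {m n} →
                   dist fi x + dist x li ≤ m → dist fj y + dist y lj ≤ n →
                   2 * dist x y ≤ m + n + (dist fi fj + dist li lj)
closedWalk-bound fi x li fj y lj {m} {n} hi hj = begin
  2 * dist x y
    ≡⟨ cong (dist x y +_) (+-identityʳ _) ⟩
  dist x y + dist x y
    ≤⟨ +-mono-≤ viaFirsts viaLasts ⟩
  (dist fi x + (dist fi fj + dist fj y)) + (dist x li + (dist li lj + dist y lj))
    ≡⟨ regroup (dist fi x) (dist fi fj) (dist fj y) (dist x li) (dist li lj) (dist y lj) ⟩
  (dist fi x + dist x li) + (dist fj y + dist y lj) + (dist fi fj + dist li lj)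
    ≤⟨ +-monoˡ-≤ _ (+-mono-≤ hi hj) ⟩
  m + n + (dist fi fj + dist li lj) ∎
  where
  viaFirsts : dist x y ≤ dist fi x + (dist fi fj + dist fj y)
  viaFirsts = ≤-trans (dist-triangle x fi y) (+-mono-≤ (≤-reflexive (dist-sym x fi)) (dist-triangle fi fj y))
  viaLasts : dist x y ≤ dist x li + (dist li lj + dist y lj)
  viaLasts = ≤-trans (dist-triangle x li y)
               (+-monoʳ-≤ _ (≤-trans (dist-triangle li lj y) (≤-reflexive (cong (dist li lj +_) (dist-sym lj y)))))
  regroup : ∀ a b c d e f → (a + (b + c)) + (d + (e + f)) ≡ (a + d) + (c + f) + (b + e)
  regroup = solve-∀

cross : ∀ {A B : Set} → (A → Bool) → (B → Bool) → A × B → ℕ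
cross f g (a , b) = dist (f a) (g b)

crossings : ∀ {A B : Set} → (A → Bool) → (B → Bool) → List (A × B) → ℕ
crossings f g es = sum (map (cross f g) es)

module _ {A B : Set} {f : A → Bool} {g : B → Bool} where

  crossings-++ : ∀ xs ys → crossings f g (xs ++ ys) ≡ crossings f g xs + crossings f g ys
  crossings-++ xs ys = trans (cong sum (map-++ (cross f g) xs ys)) (sum-++ (map (cross f g) xs) _)

  crossings-map : ∀ {C : Set} (h : C → A × B) es → crossings f g (map h es) ≡ sum (map (cross f g ∘ h) es)
  crossings-map h es = cong sum (sym (map-∘ es))

  crossings-concatMap : ∀ {C : Set} n (h : C → List (A × B)) (ι : Fin n → C) →
                        crossings f g (concatMap h (tabulate ι)) ≡ ∑[ i < n ] crossings f g (h (ι i))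
  crossings-concatMap zero    h ι = refl
  crossings-concatMap (suc n) h ι =
    trans (crossings-++ (h (ι zero)) _) (cong (_ +_) (crossings-concatMap n h (ι ∘ suc)))

-- `false` on the empty path; the parts of a partition are never empty.
first : ∀ {m} → (Fin m → Bool) → Bool
first {zero}  g = false
first {suc m} g = g zero

last : ∀ {m} → (Fin m → Bool) → Bool
last {zero}  g = false
last {suc m} g = g (fromℕ m)

pathCut : ∀ m → (Fin m → Bool) → ℕ
pathCut zero          g = 0
pathCut (suc zero)    g = 0
pathCut (suc (suc m)) g = dist (g zero) (g (suc zero)) + pathCut (suc m) (g ∘ suc)

cycleCut : ∀ m → (Fin m → Bool) → ℕ
cycleCut m g = pathCut m g + dist (last g) (first g)

pathCut-ends : ∀ m (g : Fin m → Bool) → dist (first g) (last g) ≤ pathCut m g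
pathCut-ends zero          g = z≤n
pathCut-ends (suc zero)    g = ≤-reflexive (dist-refl (g zero))
pathCut-ends (suc (suc m)) g =
  ≤-trans (dist-triangle (g zero) (g (suc zero)) (last g))
          (+-monoʳ-≤ (dist (g zero) (g (suc zero))) (pathCut-ends (suc m) (g ∘ suc)))

pathCut-through-first : ∀ m (g : Fin m → Bool) →
                        dist (first g) (first g) + dist (first g) (last g) ≤ pathCut m g
pathCut-through-first m g =
  subst (_≤ pathCut m g) (cong (_+ dist (first g) (last g)) (sym (dist-refl (first g)))) (pathCut-ends m g)

pathCut-through : ∀ m (g : Fin m → Bool) c → dist (first g) (g c) + dist (g c) (last g) ≤ pathCut m g
pathCut-through (suc m)       g zero    = pathCut-through-first (suc m) g
pathCut-through (suc (suc m)) g (suc c) = begin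
  dist g₀ gc + dist gc gₗ                ≤⟨ +-monoˡ-≤ _ (dist-triangle g₀ g₁ gc) ⟩
  (dist g₀ g₁ + dist g₁ gc) + dist gc gₗ ≡⟨ +-assoc (dist g₀ g₁) _ _ ⟩
  dist g₀ g₁ + (dist g₁ gc + dist gc gₗ) ≤⟨ +-monoʳ-≤ _ (pathCut-through (suc m) (g ∘ suc) c) ⟩
  pathCut (suc (suc m)) g                ∎
  where
  g₀ = g zero
  g₁ = g (suc zero)
  gc = g (suc c)
  gₗ = last g

cycleCut-≥ : ∀ m (g : Fin m → Bool) a b → 2 * dist (g a) (g b) ≤ cycleCut m g
cycleCut-≥ m g a b = cycle-bound (first g) (last g) (g a) (g b) (pathCut-through m g a) (pathCut-through m g b)

crossings-pathArcs : ∀ m (g : Fin m → Bool) → crossings g g (pathArcs m) ≡ 2 * pathCut m g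
crossings-pathArcs zero          g = refl
crossings-pathArcs (suc zero)    g = refl
crossings-pathArcs (suc (suc m)) g = begin-equality
  crossings g g (pathArcs (suc (suc m)))
    ≡⟨ cong₂ (λ s t → d + (s + t)) (dist-sym (g (suc zero)) (g zero))
             (trans (crossings-map {f = g} {g = g} _ (pathArcs (suc m))) (crossings-pathArcs (suc m) (g ∘ suc))) ⟩
  d + (d + 2 * pathCut (suc m) (g ∘ suc))
    ≡⟨ double d (pathCut (suc m) (g ∘ suc)) ⟩
  2 * pathCut (suc (suc m)) g ∎
  where
  d = dist (g zero) (g (suc zero))
  double : ∀ a b → a + (a + 2 * b) ≡ 2 * (a + b)
  double = solve-∀

crossings-cycleArcs : ∀ m (g : Fin m → Bool) → crossings g g (cycleArcs m) ≡ 2 * cycleCut m g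
crossings-cycleArcs zero    g = refl
crossings-cycleArcs (suc m) g = begin-equality
  crossings g g (cycleArcs (suc m))
    ≡⟨ crossings-++ {f = g} {g = g} (pathArcs (suc m)) ((fromℕ m , zero) ∷ (zero , fromℕ m) ∷ []) ⟩
  crossings g g (pathArcs (suc m)) + (dist (last g) (first g) + (dist (first g) (last g) + 0))
    ≡⟨ cong₂ _+_ (crossings-pathArcs (suc m) g)
                 (cong (dist (last g) (first g) +_) (trans (+-identityʳ _) (dist-sym (first g) (last g)))) ⟩
  2 * pathCut (suc m) g + (dist (last g) (first g) + dist (last g) (first g))
    ≡⟨ double (pathCut (suc m) g) (dist (last g) (first g)) ⟩
  2 * cycleCut (suc m) g ∎
  where
  double : ∀ a b → 2 * a + (b + b) ≡ 2 * (a + b)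
  double = solve-∀

crossings-endArcs : ∀ {a b} {g : Fin a → Bool} {h : Fin b → Bool} → 1 ≤ a → 1 ≤ b →
                    crossings g h (endArcs a b) ≡ dist (first g) (first h) + dist (last g) (last h)
crossings-endArcs {g = g} {h} (s≤s _) (s≤s _) = cong (dist (g zero) (h zero) +_) (+-identityʳ _)

next-inject₁ : ∀ {m} (i : Fin m) → next {suc m} (inject₁ i) ≡ suc i
next-inject₁ {m} i = toℕ-injective (begin-equality
  toℕ (next (inject₁ i))        ≡⟨ toℕ-fromℕ< _ ⟩
  suc (toℕ (inject₁ i)) % suc m ≡⟨ cong (λ t → suc t % suc m) (toℕ-inject₁ i) ⟩
  suc (toℕ i) % suc m           ≡⟨ m<n⇒m%n≡m (s≤s (toℕ<n i)) ⟩
  suc (toℕ i)                   ∎)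

next-fromℕ : ∀ m → next {suc m} (fromℕ m) ≡ zero
next-fromℕ m = toℕ-injective (begin-equality
  toℕ (next (fromℕ m))        ≡⟨ toℕ-fromℕ< _ ⟩
  suc (toℕ (fromℕ m)) % suc m ≡⟨ cong (λ t → suc t % suc m) (toℕ-fromℕ m) ⟩
  suc m % suc m               ≡⟨ n%n≡0 (suc m) ⟩
  0                           ∎)

pathCut≡∑ : ∀ m (g : Fin (suc m) → Bool) → pathCut (suc m) g ≡ ∑[ i < m ] dist (g (inject₁ i)) (g (suc i))
pathCut≡∑ zero    g = refl
pathCut≡∑ (suc m) g = cong (dist (g zero) (g (suc zero)) +_) (pathCut≡∑ m (g ∘ suc))

∑-next≡cycleCut : ∀ m (g : Fin (suc m) → Bool) → ∑[ i < suc m ] dist (g i) (g (next i)) ≡ cycleCut (suc m) g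
∑-next≡cycleCut m g = begin-equality
  ∑[ i < suc m ] dist (g i) (g (next i))
    ≡⟨ sum-init-last (λ i → dist (g i) (g (next i))) ⟩
  ∑[ i < m ] dist (g (inject₁ i)) (g (next (inject₁ i))) + dist (last g) (g (next (fromℕ m)))
    ≡⟨ cong₂ _+_ (sum-cong-≗ (λ i → cong (dist (g (inject₁ i)) ∘ g) (next-inject₁ i)))
                 (cong (dist (last g) ∘ g) (next-fromℕ m)) ⟩
  ∑[ i < m ] dist (g (inject₁ i)) (g (suc i)) + dist (last g) (first g)
    ≡⟨ cong (_+ dist (last g) (first g)) (pathCut≡∑ m g) ⟨
  cycleCut (suc m) g ∎

∑-pick : ∀ {n} (t : Fin n → ℕ) i → t i ≤ ∑[ i < n ] t i
∑-pick {suc n} t i = ≤-trans (m≤m+n (t i) _) (≤-reflexive (sym (sum-remove {i = i} t)))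

∑-pick₂ : ∀ {n} (t : Fin (suc n) → ℕ) {i j} → i ≢ j → t i + t j ≤ ∑[ i < suc n ] t i
∑-pick₂ {n} t {i} {j} i≢j = begin
  t i + t j                            ≡⟨ cong (λ j → t i + t j) (punchIn-punchOut i≢j) ⟨
  t i + removeAt t i (punchOut i≢j)    ≤⟨ +-monoʳ-≤ (t i) (∑-pick (removeAt t i) _) ⟩
  t i + ∑[ j < n ] removeAt t i j      ≡⟨ sum-remove t ⟨
  ∑[ i < suc n ] t i                   ∎

private
  mutual
    countCut : ∀ {k} (η : Vec ℕ k) → (Vertex η → Bool) → List (Vertex η × Vertex η) → ℕ
    countCut η X = _

    -- Abstracting over `arcs η` lets unification name the local counter of `cutSize`.
    cutSize≡countCut : ∀ {k} (η : Vec ℕ k) X → cutSize η X ≡ countCut η X (arcs η)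
    cutSize≡countCut η X with arcs η
    ... | es = refl

  countCut≡crossings : ∀ {k} (η : Vec ℕ k) X es → countCut η X es ≡ crossings X X es
  countCut≡crossings η X []       = refl
  countCut≡crossings η X (e ∷ es) = cong (cross X X e +_) (countCut≡crossings η X es)

cutSize≡crossings : ∀ {k} (η : Vec ℕ k) X → cutSize η X ≡ crossings X X (arcs η)
cutSize≡crossings η X = trans (cutSize≡countCut η X) (countCut≡crossings η X (arcs η))

-- Definitionally the local `arcsOf` of `arcs`, so that for k ≥ 2 `arcs η` reduces to
-- `concatMap (partArcs η) (allFin k)`.
partArcs : ∀ {k} (η : Vec ℕ k) → Fin k → List (Vertex η × Vertex η)
partArcs η i =
  map (λ { (a , b) → ((i , a) , (i , b)) }) (pathArcs (lookup η i)) ++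
  map (λ { (a , b) → ((i , a) , (next i , b)) }) (endArcs (lookup η i) (lookup η (next i)))

module _ {k} (η : Vec ℕ k) (X : Vertex η → Bool) where

  colouring : (i : Fin k) → Fin (lookup η i) → Bool
  colouring i a = X (i , a)

  firsts lasts : Fin k → Bool
  firsts i = first (colouring i)
  lasts  i = last (colouring i)

  partCut : Fin k → ℕ
  partCut i = pathCut (lookup η i) (colouring i)

  partCut-through : ∀ {i x} a → X (i , a) ≡ x → dist (firsts i) x + dist x (lasts i) ≤ partCut i
  partCut-through {i} a refl = pathCut-through (lookup η i) (colouring i) a

  crossings-partArcs : All (1 ≤_) η → ∀ i →
    crossings X X (partArcs η i) ≡
      2 * partCut i + (dist (firsts i) (firsts (next i)) + dist (lasts i) (lasts (next i)))
  crossings-partArcs pos i = begin-equality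
    crossings X X (partArcs η i)
      ≡⟨ crossings-++ {f = X} {g = X} (map _ (pathArcs (lookup η i))) _ ⟩
    crossings X X (map _ (pathArcs (lookup η i))) + crossings X X (map _ (endArcs (lookup η i) (lookup η (next i))))
      ≡⟨ cong₂ _+_ (crossings-map {f = X} {g = X} _ (pathArcs (lookup η i)))
                   (crossings-map {f = X} {g = X} _ (endArcs (lookup η i) (lookup η (next i)))) ⟩
    crossings (colouring i) (colouring i) (pathArcs (lookup η i)) +
    crossings (colouring i) (colouring (next i)) (endArcs (lookup η i) (lookup η (next i)))
      ≡⟨ cong₂ _+_ (crossings-pathArcs (lookup η i) (colouring i))
                   (crossings-endArcs (lookup⁺ pos i) (lookup⁺ pos (next i))) ⟩
    2 * partCut i + (dist (firsts i) (firsts (next i)) + dist (lasts i) (lasts (next i))) ∎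

cutSize-cycle : ∀ p (X : Vertex (p ∷ []) → Bool) → cutSize (p ∷ []) X ≡ 2 * cycleCut p (colouring (p ∷ []) X zero)
cutSize-cycle p X =
  trans (cutSize≡crossings (p ∷ []) X)
        (trans (crossings-map {f = X} {g = X} _ (cycleArcs p)) (crossings-cycleArcs p (colouring (p ∷ []) X zero)))

cutSize-by-parts : ∀ {k} (η : Vec ℕ (suc (suc k))) X → All (1 ≤_) η →
  cutSize η X ≡ 2 * ∑[ i < suc (suc k) ] partCut η X i + (cycleCut _ (firsts η X) + cycleCut _ (lasts η X))
cutSize-by-parts {k} η@(_ ∷ _ ∷ _) X pos = begin-equality
  cutSize η X
    ≡⟨ cutSize≡crossings η X ⟩
  crossings X X (concatMap (partArcs η) (tabulate id))
    ≡⟨ crossings-concatMap {f = X} {g = X} K (partArcs η) id ⟩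
  ∑[ i < K ] crossings X X (partArcs η i)
    ≡⟨ sum-cong-≗ (crossings-partArcs η X pos) ⟩
  ∑[ i < K ] (2 * P i + (jumpF i + jumpL i))
    ≡⟨ ∑-distrib-+ (λ i → 2 * P i) (λ i → jumpF i + jumpL i) ⟩
  ∑[ i < K ] (2 * P i) + ∑[ i < K ] (jumpF i + jumpL i)
    ≡⟨ cong₂ _+_ (sym (*-distribˡ-sum 2 P)) (∑-distrib-+ jumpF jumpL) ⟩
  2 * ∑[ i < K ] P i + (∑[ i < K ] jumpF i + ∑[ i < K ] jumpL i)
    ≡⟨ cong (2 * ∑[ i < K ] P i +_)
            (cong₂ _+_ (∑-next≡cycleCut (suc k) (firsts η X)) (∑-next≡cycleCut (suc k) (lasts η X))) ⟩
  2 * ∑[ i < K ] P i + (cycleCut K (firsts η X) + cycleCut K (lasts η X)) ∎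
  where
  K = suc (suc k)
  P : Fin K → ℕ
  P = partCut η X
  jumpF jumpL : Fin K → ℕ
  jumpF i = dist (firsts η X i) (firsts η X (next i))
  jumpL i = dist (lasts η X i) (lasts η X (next i))

cutSize-≥-pair : ∀ {k} (η : Vec ℕ (suc (suc k))) X → All (1 ≤_) η → ∀ {i j} → i ≢ j →
  2 * (partCut η X i + partCut η X j + (dist (firsts η X i) (firsts η X j) + dist (lasts η X i) (lasts η X j)))
    ≤ cutSize η X
cutSize-≥-pair {k} η X pos {i} {j} i≢j = begin
  2 * (P i + P j + (dist (F i) (F j) + dist (L i) (L j)))
    ≡⟨ distrib (P i + P j) (dist (F i) (F j)) (dist (L i) (L j)) ⟩
  2 * (P i + P j) + (2 * dist (F i) (F j) + 2 * dist (L i) (L j))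
    ≤⟨ +-mono-≤ (*-monoʳ-≤ 2 (∑-pick₂ P i≢j)) (+-mono-≤ (cycleCut-≥ K F i j) (cycleCut-≥ K L i j)) ⟩
  2 * ∑[ i < K ] P i + (cycleCut K F + cycleCut K L)
    ≡⟨ cutSize-by-parts η X pos ⟨
  cutSize η X ∎
  where
  K = suc (suc k)
  P : Fin K → ℕ
  P = partCut η X
  F L : Fin K → Bool
  F = firsts η X
  L = lasts η X
  distrib : ∀ a b c → 2 * (a + (b + c)) ≡ 2 * a + (2 * b + 2 * c)
  distrib = solve-∀

cutSize-≥-4 : ∀ {k} (η : Vec ℕ (suc (suc k))) X → All (1 ≤_) η → ∀ {i j x y} → i ≢ j → x ≢ y →
  dist (firsts η X i) x + dist x (lasts η X i) ≤ partCut η X i →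
  dist (firsts η X j) y + dist y (lasts η X j) ≤ partCut η X j →
  4 ≤ cutSize η X
cutSize-≥-4 η X pos {i} {j} {x} {y} i≢j x≢y hi hj = begin
  4                   ≡⟨ cong (λ d → 2 * (2 * d)) (dist-≢ x≢y) ⟨
  2 * (2 * dist x y)  ≤⟨ *-monoʳ-≤ 2 (closedWalk-bound (F i) x (L i) (F j) y (L j) hi hj) ⟩
  2 * (partCut η X i + partCut η X j + (dist (F i) (F j) + dist (L i) (L j)))
                      ≤⟨ cutSize-≥-pair η X pos i≢j ⟩
  cutSize η X         ∎
  where
  F = firsts η X
  L = lasts η X

lemma7 : (n k : ℕ) → 1 ≤ k → k ≤ n → (η : Vec ℕ k) → IsPartition n k η →
         (X : Vertex η → Bool) →
         (∃ λ v → X v ≡ true) → (∃ λ w → X w ≡ false) →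
         4 ≤ cutSize η X
lemma7 _ (suc zero) _ _ η@(p ∷ []) _ X ((zero , a) , Xa) ((zero , b) , Xb) = begin
  4                                           ≡⟨ cong₂ (λ u v → 2 * (2 * dist u v)) Xa Xb ⟨
  2 * (2 * dist (colouring η X zero a) (colouring η X zero b))
                                              ≤⟨ *-monoʳ-≤ 2 (cycleCut-≥ p (colouring η X zero) a b) ⟩
  2 * cycleCut p (colouring η X zero)         ≡⟨ cutSize-cycle p X ⟨
  cutSize η X                                 ∎
lemma7 _ (suc (suc k)) _ _ η@(_ ∷ _ ∷ _) (pos , _) X ((i , a) , Xa) ((j , b) , Xb) with i ≟ j
... | no i≢j   = cutSize-≥-4 η X pos i≢j (λ ()) (partCut-through η X a Xa) (partCut-through η X b Xb)
... | yes refl = cutSize-≥-4 η X pos (punchInᵢ≢i i zero ∘ sym) (not-¬ refl ∘ sym)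
                   (opposite (firsts η X other)) (pathCut-through-first _ (colouring η X other))
  where
  other = punchIn i zero
  opposite : ∀ y → dist (firsts η X i) (not y) + dist (not y) (lasts η X i) ≤ partCut η X i
  opposite true  = partCut-through η X b Xb
  opposite false = partCut-through η X a Xa
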